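{- Let $1\le a_1\le a_2\le\cdots\le a_n\le n$ be a nondecreasing sequence of integers having exactly one fixed point, i.e. exactly one index $f\in\{1,\dots,n\}$ with $a_f=f$. Define $a'_y=a_y-y$ for $y\le f$ and $a'_z=z-a_z$ for $f<z\le n$. If $x<y<z<f$ are indices with $a'_x>a'_y$, $a'_z>a'_y$ and $a'_x>a'_z$, then there is an index $w$ with $x<w<y$ such that $a'_w=a'_z$. -}

module Defs where

open import Data.Nat using (ℕ; _≤_; _<_; _≤?_)
open import Relation.Nullary using (yes; no)
open import Data.Integer using (ℤ; _-_; +_)
open import Data.Product using (_×_)
open import Relation.Binary.PropositionalEquality using (_≡_)

-- A sequence a_1,...,a_n is modelled as a function a : ℕ → ℕ, of which only
-- the values at indices 1..n matter.

ValidSeq : ℕ → (ℕ → ℕ) → Set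
ValidSeq n a =
  (∀ i → 1 ≤ i → i ≤ n → 1 ≤ a i × a i ≤ n) ×
  (∀ i j → 1 ≤ i → i ≤ j → j ≤ n → a i ≤ a j)

UniqueFixedPoint : ℕ → (ℕ → ℕ) → ℕ → Set
UniqueFixedPoint n a f =
  1 ≤ f × f ≤ n × a f ≡ f × (∀ i → 1 ≤ i → i ≤ n → a i ≡ i → i ≡ f)

a′ : (ℕ → ℕ) → ℕ → ℕ → ℤ
a′ a f y with y ≤? f
... | yes _ = + a y - + y
... | no _ = + y - + a y

module Submission where

-- Below the fixed point, a′ y = a y - y, and since a is
-- nondecreasing, a′ can drop by at most one when the index grows by one:
-- a′ i ≤ a′ (i + 1) + 1.  A sequence of integers descending this slowly cannot
-- jump over a value: if it starts above c at x and ends below c at y, it takes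
-- the value c strictly between x and y (a discrete intermediate value theorem).
-- Applying this with c = a′ z on the interval [x, y] ⊆ [1, f] gives the index w;
-- the hypotheses a′ y < a′ z < a′ x supply the two boundary conditions.

open import Defs
open import Data.Nat using (ℕ; suc; _<_; _≤_; _≤?_; s≤s)
open import Data.Integer using (ℤ; _⊖_) renaming (suc to sucℤ; _<_ to _<ℤ_; _≤_ to _≤ℤ_)
open import Data.Product using (_×_; ∃-syntax; _,_)
open import Data.Sum using (inj₁; inj₂)
open import Relation.Binary.PropositionalEquality using (_≡_; refl; sym; trans; cong; subst; subst₂)
open import Relation.Binary.Definitions using (tri<; tri≈; tri>)
open import Data.Empty using (⊥-elim)
open import Relation.Nullary using (yes; no)
import Data.Nat.Properties as ℕP
import Data.Integer.Properties as ℤP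

SlowDescent : (ℕ → ℤ) → ℕ → ℕ → Set
SlowDescent d x y = ∀ i → x ≤ i → i < y → d i ≤ℤ sucℤ (d (suc i))

slow-step-below : ∀ {u v c : ℤ} → u ≤ℤ sucℤ v → v <ℤ c → u ≤ℤ c
slow-step-below u≤1+v v<c = ℤP.≤-trans u≤1+v (ℤP.i<j⇒suc[i]≤j v<c)

discrete-ivt : (d : ℕ → ℤ) (c : ℤ) (x y : ℕ) → SlowDescent d x y → x < y →
               c <ℤ d x → d y <ℤ c → ∃[ w ] (x < w × w < y × d w ≡ c)
discrete-ivt d c x (suc y′) slow (s≤s x≤y′) c<dx dy<c
  with ℕP.m≤n⇒m<n∨m≡n x≤y′
... | inj₂ refl = ⊥-elim (ℤP.<⇒≱ c<dx (slow-step-below (slow x ℕP.≤-refl ℕP.≤-refl) dy<c))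
... | inj₁ x<y′ with ℤP.<-cmp (d y′) c
...   | tri≈ _ dy′≡c _ = y′ , x<y′ , ℕP.≤-refl , dy′≡c
...   | tri> _ _ c<dy′ =
  ⊥-elim (ℤP.<⇒≱ c<dy′ (slow-step-below (slow y′ x≤y′ ℕP.≤-refl) dy<c))
...   | tri< dy′<c _ _ with discrete-ivt d c x y′ slow-on-prefix x<y′ c<dx dy′<c
  where
  slow-on-prefix : SlowDescent d x y′
  slow-on-prefix i x≤i i<y′ = slow i x≤i (ℕP.m≤n⇒m≤1+n i<y′)
...     | w , x<w , w<y′ , dw≡c = w , x<w , ℕP.m≤n⇒m≤1+n w<y′ , dw≡c

⊖-slow-step : ∀ {m m′} i → m ≤ m′ → m ⊖ i ≤ℤ sucℤ (m′ ⊖ suc i)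
⊖-slow-step {m} {m′} i m≤m′ =
  subst (m ⊖ i ≤ℤ_) (sym suc[m′⊖1+i]≡m′⊖i) (ℤP.⊖-monoˡ-≤ i m≤m′)
  where
  suc[m′⊖1+i]≡m′⊖i : sucℤ (m′ ⊖ suc i) ≡ m′ ⊖ i
  suc[m′⊖1+i]≡m′⊖i = trans (ℤP.distribʳ-⊖-+-pos 1 m′ (suc i)) (ℤP.[1+m]⊖[1+n]≡m⊖n m′ i)

a′-below : ∀ a f i → i ≤ f → a′ a f i ≡ a i ⊖ i
a′-below a f i i≤f with i ≤? f
... | yes _ = ℤP.[+m]-[+n]≡m⊖n (a i) i
... | no i≰f = ⊥-elim (i≰f i≤f)

a′-slow : ∀ n a f → ValidSeq n a → f ≤ n → ∀ x y → 1 ≤ x → y ≤ f →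
          SlowDescent (a′ a f) x y
a′-slow n a f (_ , mono) f≤n x y 1≤x y≤f i x≤i i<y =
  subst₂ _≤ℤ_ (sym (a′-below a f i (ℕP.<⇒≤ 1+i≤f)))
              (sym (cong sucℤ (a′-below a f (suc i) 1+i≤f)))
              (⊖-slow-step i a-step)
  where
  1+i≤f : suc i ≤ f
  1+i≤f = ℕP.≤-trans i<y y≤f
  a-step : a i ≤ a (suc i)
  a-step = mono i (suc i) (ℕP.≤-trans 1≤x x≤i) (ℕP.n≤1+n i) (ℕP.≤-trans 1+i≤f f≤n)

proposition5 : (n : ℕ) (a : ℕ → ℕ) (f : ℕ) → ValidSeq n a → UniqueFixedPoint n a f →
    (x y z : ℕ) → 1 Data.Nat.≤ x → x < y → y < z → z < f →
    a′ a f y <ℤ a′ a f x → a′ a f y <ℤ a′ a f z → a′ a f z <ℤ a′ a f x →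
    ∃[ w ] (x < w × w < y × a′ a f w ≡ a′ a f z)
proposition5 n a f valid (_ , f≤n , _) x y z 1≤x x<y y<z z<f _ y<z′ z<x′ =
  discrete-ivt (a′ a f) (a′ a f z) x y slow x<y z<x′ y<z′
  where
  slow : SlowDescent (a′ a f) x y
  slow = a′-slow n a f valid f≤n x y 1≤x (ℕP.<⇒≤ (ℕP.<-trans y<z z<f))
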